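{- Let $e$ be a normal expression of the split fireball calculus and let $\pi\triangleright\Gamma\vdash e:M$ be a type derivation. Then $|e|\leq|\pi|$.
   Context: Terms: $t,u ::= x \mid \lambda x.t \mid tu$, up to $\alpha$-equivalence; $t\{x\leftarrow u\}$ is capture-avoiding substitution. Values: $v ::= x \mid \lambda x.t$. Fireballs $f$ and inert terms $i$ are defined by mutual induction: $f ::= v \mid i$ and $i ::= x f_1 \dots f_n$ with $n>0$ (application left-associative). Right evaluation contexts: $C ::= \langle\cdot\rangle \mid t\,C \mid C\,f$. Split fireball calculus: environments $E ::= \epsilon \mid [x\leftarrow i]:E$; programs $p=(t,E)$; expressions are terms or programs. Reduction: $(C\langle(\lambda x.t)v\rangle,E)\to_{\beta_v}(C\langle t\{x\leftarrow v\}\rangle,E)$ and $(C\langle(\lambda x.t)i\rangle,E)\to_{\beta_i}(C\langle t\rangle,[x\leftarrow i]:E)$; $\to_{\beta_f}=\to_{\beta_v}\cup\to_{\beta_i}$. A program is normal if it has no $\to_{\beta_f}$-reduct; a normal expression is a normal program or a term $t$ such that $(t,E)$ is normal for every environment $E$. Append: $\epsilon@[x\leftarrow i]=[x\leftarrow i]$, $([y\leftarrow i']:E)@[x\leftarrow i]=[y\leftarrow i']:(E@[x\leftarrow i])$. Sizes: $|v|=0$, $|tu|=|t|+|u|+1$, $|(t,\epsilon)|=|t|$, $|(t,E@[x\leftarrow i])|=|(t,E)|+|i|$. Multi types: linear types $L ::= M\multimap N$; multi types $M,N ::= [L_1,\dots,L_n]$ (finite multisets, $n\ge 0$); $\mathbf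 0$ empty multiset, $\uplus$ multiset sum. Type context $\Gamma$: total map from variables to multi types with finite $\mathrm{dom}(\Gamma)=\{x\mid \Gamma(x)\ne\mathbf 0\}$; $(\Gamma\uplus\Delta)(x)=\Gamma(x)\uplus\Delta(x)$; $x:M$ maps $x$ to $M$ and all else to $\mathbf 0$; $\Gamma,x:M$ extends $\Gamma$ ($x\notin\mathrm{dom}(\Gamma)$) by $x\mapsto M$. Typing rules: (ax) $x:M\vdash x:M$; (@) from $\Gamma\vdash t:[M\multimap N]$ and $\Delta\vdash u:M$ infer $\Gamma\uplus\Delta\vdash tu:N$; ($\lambda$) from $\Gamma_k,x:M_k\vdash t:N_k$ for $k=1,\dots,n$ ($n\ge0$) infer $\Gamma_1\uplus\dots\uplus\Gamma_n\vdash\lambda x.t:[M_1\multimap N_1,\dots,M_n\multimap N_n]$; (es$_\epsilon$) from $\Gamma\vdash t:M$ infer $\Gamma\vdash (t,\epsilon):M$; (es$_@$) from $\Gamma,x:M\vdash(t,E):N$ and $\Delta\vdash i:M$ infer $\Gamma\uplus\Delta\vdash(t,E@[x\leftarrow i]):N$. $|\pi|$ is the number of (@) rules in $\pi$. -}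

module Defs where

open import Data.Nat using (ℕ; zero; suc; _+_; _≤_; _⊔_; _≡ᵇ_; _≟_)
open import Data.List using (List; []; _∷_; _++_; map; foldr; filter)
open import Data.Bool using (if_then_else_)
open import Data.Product using (Σ; _×_; _,_)
open import Relation.Nullary using (¬_; ¬?)
open import Relation.Binary.PropositionalEquality using (_≡_)

-- Terms (named variables, raw syntax; all notions below are α-invariant)

Var : Set
Var = ℕ

data Tm : Set where
  var : Var → Tm
  lam : Var → Tm → Tm
  app : Tm → Tm → Tm

fv : Tm → List Var
fv (var x)   = x ∷ []
fv (lam y t) = filter (λ w → ¬? (w ≟ y)) (fv t)
fv (app t u) = fv t ++ fv u

maxFV : Tm → ℕ
maxFV u = foldr _⊔_ 0 (fv u)

-- capture-avoiding simultaneous substitution (binders are renamed to a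
-- variable fresh for the substituted free variables)
Subst : Set
Subst = Var → Tm

_⟨_↦_⟩ : Subst → Var → Tm → Subst
(σ ⟨ x ↦ u ⟩) y = if y ≡ᵇ x then u else σ y

subst : Subst → Tm → Tm
subst σ (var y)   = σ y
subst σ (app t u) = app (subst σ t) (subst σ u)
subst σ (lam y t) = lam z (subst (σ ⟨ y ↦ var z ⟩) t)
  where
  z : Var
  z = suc (foldr _⊔_ 0 (map (λ w → maxFV (σ w)) (fv (lam y t))))

_[_←_] : Tm → Var → Tm → Tm
t [ x ← u ] = subst (var ⟨ x ↦ u ⟩) t

data Value : Tm → Set where
  var : ∀ x → Value (var x)
  lam : ∀ x t → Value (lam x t)

mutual
  data Fireball : Tm → Set where
    val   : ∀ {t} → Value t → Fireball t
    inert : ∀ {t} → Inert t → Fireball t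

  data Inert : Tm → Set where
    base : ∀ {x f} → Fireball f → Inert (app (var x) f)
    ext  : ∀ {i f} → Inert i → Fireball f → Inert (app i f)

data ECtx : Set where
  hole : ECtx
  _·ᶜ_ : Tm → ECtx → ECtx
  ᶜ·   : ECtx → (f : Tm) → Fireball f → ECtx

plug : ECtx → Tm → Tm
plug hole         s = s
plug (t ·ᶜ C)     s = app t (plug C s)
plug (ᶜ· C f _)   s = app (plug C s) f

data Env : Set where
  ε    : Env
  cons : (x : Var) (i : Tm) → Inert i → Env → Env

snoc : Env → (x : Var) (i : Tm) → Inert i → Env
snoc ε              x i ii = cons x i ii ε
snoc (cons y j jj E) x i ii = cons y j jj (snoc E x i ii)

Prog : Set
Prog = Tm × Env

data Expr : Set where
  term : Tm → Expr
  prog : Prog → Expr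

data _→βf_ : Prog → Prog → Set where
  βv : ∀ {C x t v E} → Value v →
       (plug C (app (lam x t) v) , E) →βf (plug C (t [ x ← v ]) , E)
  βi : ∀ {C x t i E} (ii : Inert i) →
       (plug C (app (lam x t) i) , E) →βf (plug C t , cons x i ii E)

NormalProg : Prog → Set
NormalProg p = ∀ p′ → ¬ (p →βf p′)

NormalExpr : Expr → Set
NormalExpr (prog p) = NormalProg p
NormalExpr (term t) = ∀ (E : Env) → NormalProg (t , E)

size : Tm → ℕ
size (var _)   = 0
size (lam _ _) = 0
size (app t u) = size t + size u + 1

sizeEnv : Env → ℕ
sizeEnv ε              = 0
sizeEnv (cons _ i _ E) = size i + sizeEnv E

-- |(t,ε)| = |t|,  |(t,E@[x←i])| = |(t,E)| + |i|
sizeProg : Prog → ℕ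
sizeProg (t , E) = size t + sizeEnv E

sizeExpr : Expr → ℕ
sizeExpr (term t) = size t
sizeExpr (prog p) = sizeProg p

-- Multi types.  Multisets are lists taken up to (nested) permutation.

data LTy : Set where
  _⊸_ : List LTy → List LTy → LTy

MTy : Set
MTy = List LTy

𝟎 : MTy
𝟎 = []

mutual
  data _≈ᴸ_ : LTy → LTy → Set where
    ⊸-cong : ∀ {M M′ N N′} → M ≈ᴹ M′ → N ≈ᴹ N′ → (M ⊸ N) ≈ᴸ (M′ ⊸ N′)

  data _≈ᴹ_ : MTy → MTy → Set where
    []    : [] ≈ᴹ []
    _∷_   : ∀ {L L′ M M′} → L ≈ᴸ L′ → M ≈ᴹ M′ → (L ∷ M) ≈ᴹ (L′ ∷ M′)
    swap  : ∀ {L L′ M} → (L ∷ L′ ∷ M) ≈ᴹ (L′ ∷ L ∷ M)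
    trans : ∀ {M M′ M″} → M ≈ᴹ M′ → M′ ≈ᴹ M″ → M ≈ᴹ M″

Ctx : Set
Ctx = Var → MTy

_≈ᶜ_ : Ctx → Ctx → Set
Γ ≈ᶜ Δ = ∀ x → Γ x ≈ᴹ Δ x

∅ : Ctx
∅ _ = 𝟎

_⊎_ : Ctx → Ctx → Ctx
(Γ ⊎ Δ) y = Γ y ++ Δ y

⟦_∶_⟧ : Var → MTy → Ctx
⟦ x ∶ M ⟧ y = if y ≡ᵇ x then M else 𝟎

-- Γ , x : M   (used only under the side condition Γ x ≡ 𝟎)
_▸_≔_ : Ctx → Var → MTy → Ctx
(Γ ▸ x ≔ M) y = if y ≡ᵇ x then M else Γ y

-- Type derivations.  'conv' only identifies judgments that are equal as
-- multisets (lists up to permutation); it contains no (@) rule.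

mutual
  data _⊢_⦂_ : Ctx → Tm → MTy → Set where
    ax   : ∀ {x M} → ⟦ x ∶ M ⟧ ⊢ var x ⦂ M
    appR : ∀ {Γ Δ t u M N} → Γ ⊢ t ⦂ ((M ⊸ N) ∷ []) → Δ ⊢ u ⦂ M →
           (Γ ⊎ Δ) ⊢ app t u ⦂ N
    lamR : ∀ {Γ x t A} → LamPremises x t Γ A → Γ ⊢ lam x t ⦂ A
    conv : ∀ {Γ Γ′ t M M′} → Γ ⊢ t ⦂ M → Γ ≈ᶜ Γ′ → M ≈ᴹ M′ → Γ′ ⊢ t ⦂ M′

  -- the n ≥ 0 premises Γₖ , x : Mₖ ⊢ t : Nₖ of rule (λ)
  data LamPremises (x : Var) (t : Tm) : Ctx → MTy → Set where
    []  : LamPremises x t ∅ []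
    _∷_ : ∀ {Γ Δ M N A} → Σ (Γ x ≡ 𝟎) (λ _ → (Γ ▸ x ≔ M) ⊢ t ⦂ N) →
          LamPremises x t Δ A → LamPremises x t (Γ ⊎ Δ) ((M ⊸ N) ∷ A)

data _⊢ₚ_⦂_ : Ctx → Prog → MTy → Set where
  es-ε : ∀ {Γ t M} → Γ ⊢ t ⦂ M → Γ ⊢ₚ (t , ε) ⦂ M
  es-snoc : ∀ {Γ Δ t E x i M N} (ii : Inert i) → Γ x ≡ 𝟎 →
         (Γ ▸ x ≔ M) ⊢ₚ (t , E) ⦂ N → Δ ⊢ i ⦂ M →
         (Γ ⊎ Δ) ⊢ₚ (t , snoc E x i ii) ⦂ N
  conv : ∀ {Γ Γ′ p M M′} → Γ ⊢ₚ p ⦂ M → Γ ≈ᶜ Γ′ → M ≈ᴹ M′ → Γ′ ⊢ₚ p ⦂ M′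

Deriv : Ctx → Expr → MTy → Set
Deriv Γ (term t) M = Γ ⊢ t ⦂ M
Deriv Γ (prog p) M = Γ ⊢ₚ p ⦂ M

mutual
  ∣_∣ : ∀ {Γ t M} → Γ ⊢ t ⦂ M → ℕ
  ∣ ax ∣           = 0
  ∣ appR π ρ ∣     = ∣ π ∣ + ∣ ρ ∣ + 1
  ∣ lamR ps ∣      = ∣ ps ∣λ
  ∣ conv π _ _ ∣   = ∣ π ∣

  ∣_∣λ : ∀ {x t Γ A} → LamPremises x t Γ A → ℕ
  ∣ [] ∣λ            = 0
  ∣ (_ , π) ∷ ps ∣λ  = ∣ π ∣ + ∣ ps ∣λ

∣_∣ₚ : ∀ {Γ p M} → Γ ⊢ₚ p ⦂ M → ℕ
∣ es-ε π ∣ₚ         = ∣ π ∣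
∣ es-snoc _ _ π ρ ∣ₚ   = ∣ π ∣ₚ + ∣ ρ ∣
∣ conv π _ _ ∣ₚ     = ∣ π ∣ₚ

∣_∣ₑ : ∀ {Γ e M} → Deriv Γ e M → ℕ
∣_∣ₑ {e = term _} π = ∣ π ∣
∣_∣ₑ {e = prog _} π = ∣ π ∣ₚ

-- The term of a normal program is a fireball: a β-redex in right evaluation
-- position would fire, as its argument is a value or an inert term. Every
-- application node of a fireball is typed by its own (@) rule, and each
-- environment entry contributes a typed inert term, so the (@) rules of the
-- derivation account for every application of the program.
module Submission where

open import Defs
open import Data.Nat using (_≤_; _+_; z≤n)
open import Data.Nat.Properties using (+-mono-≤; +-assoc; +-identityʳ; ≤-refl)
open import Data.Product using (_,_)
open import Data.Empty using (⊥-elim)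
open import Relation.Binary.PropositionalEquality using (_≡_; cong; module ≡-Reasoning)

normal-appʳ : ∀ {t u E} → NormalProg (app t u , E) → NormalProg (u , E)
normal-appʳ {t} n _ (βv {C} v) = n _ (βv {C = t ·ᶜ C} v)
normal-appʳ {t} n _ (βi {C} i) = n _ (βi {C = t ·ᶜ C} i)

normal-appˡ : ∀ {t u E} → Fireball u → NormalProg (app t u , E) → NormalProg (t , E)
normal-appˡ {u = u} f n _ (βv {C} v) = n _ (βv {C = ᶜ· C u f} v)
normal-appˡ {u = u} f n _ (βi {C} i) = n _ (βi {C = ᶜ· C u f} i)

normal⇒fireball : ∀ t {E} → NormalProg (t , E) → Fireball t
normal⇒fireball (var x)   _ = val (var x)
normal⇒fireball (lam x t) _ = val (lam x t)
normal⇒fireball (app t u) n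
  with normal⇒fireball u (normal-appʳ n)
... | fu with normal⇒fireball t (normal-appˡ fu n)
...   | val (var x)         = inert (base fu)
...   | inert i             = inert (ext i fu)
normal⇒fireball (app (lam x s) u) n | val v   | val (lam _ _) = ⊥-elim (n _ (βv {C = hole} v))
normal⇒fireball (app (lam x s) u) n | inert i | val (lam _ _) = ⊥-elim (n _ (βi {C = hole} i))

fireball-size≤ : ∀ {Γ t M} → Fireball t → (π : Γ ⊢ t ⦂ M) → size t ≤ ∣ π ∣
fireball-size≤ _                   ax           = z≤n
fireball-size≤ _                   (lamR _)     = z≤n
fireball-size≤ f                   (conv π _ _) = fireball-size≤ f π
fireball-size≤ (val ())            (appR π ρ)
fireball-size≤ (inert (base f))    (appR π ρ) =
  +-mono-≤ (+-mono-≤ (z≤n {∣ π ∣}) (fireball-size≤ f ρ)) ≤-refl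
fireball-size≤ (inert (ext i f))   (appR π ρ) =
  +-mono-≤ (+-mono-≤ (fireball-size≤ (inert i) π) (fireball-size≤ f ρ)) ≤-refl

sizeEnv-snoc : ∀ E x i (ii : Inert i) → sizeEnv (snoc E x i ii) ≡ sizeEnv E + size i
sizeEnv-snoc ε               x i ii = +-identityʳ (size i)
sizeEnv-snoc (cons y j jj E) x i ii = begin
  size j + sizeEnv (snoc E x i ii)  ≡⟨ cong (size j +_) (sizeEnv-snoc E x i ii) ⟩
  size j + (sizeEnv E + size i)     ≡⟨ +-assoc (size j) (sizeEnv E) (size i) ⟨
  size j + sizeEnv E + size i       ∎
  where open ≡-Reasoning

sizeProg-snoc : ∀ t E x i (ii : Inert i) →
                sizeProg (t , snoc E x i ii) ≡ sizeProg (t , E) + size i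
sizeProg-snoc t E x i ii = begin
  size t + sizeEnv (snoc E x i ii)  ≡⟨ cong (size t +_) (sizeEnv-snoc E x i ii) ⟩
  size t + (sizeEnv E + size i)     ≡⟨ +-assoc (size t) (sizeEnv E) (size i) ⟨
  size t + sizeEnv E + size i       ∎
  where open ≡-Reasoning

prog-size≤ : ∀ {Γ t E M} → Fireball t → (π : Γ ⊢ₚ (t , E) ⦂ M) → sizeProg (t , E) ≤ ∣ π ∣ₚ
prog-size≤ {t = t} f (es-ε π) rewrite +-identityʳ (size t) = fireball-size≤ f π
prog-size≤ {t = t} f (es-snoc {E = E} {x = x} {i = i} ii _ π ρ)
  rewrite sizeProg-snoc t E x i ii = +-mono-≤ (prog-size≤ f π) (fireball-size≤ (inert ii) ρ)
prog-size≤ f (conv π _ _) = prog-size≤ f π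

proposition5 : ∀ {Γ M} (e : Expr) → NormalExpr e → (π : Deriv Γ e M) → sizeExpr e ≤ ∣ π ∣ₑ
proposition5 (term t)       n π = fireball-size≤ (normal⇒fireball t (n ε)) π
proposition5 (prog (t , E)) n π = prog-size≤ (normal⇒fireball t n) π
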